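{- For every prime power $q$ and every integer $k\ge 1$ we have $n'_q(k,1)=2k$ and $n'_q(k,2)=\lceil 3k/2\rceil$.
   Context: An $[n,k]_q$-code is a $k$-dimensional subspace of $\mathbb{F}_q^n$. A linear code $C\subseteq\mathbb{F}_q^n$ has locality $r$ if for every coordinate $i$ there is a set $S_i\subseteq\{1,\dots,n\}\setminus\{i\}$ with $|S_i|\le r$ such that any two codewords agreeing on all coordinates in $S_i$ also agree in coordinate $i$. $n'_q(k,r)$ denotes the minimum length $n$ of an $[n,k]_q$-code with locality $r$. -}

module Defs where

open import Level using (Level; _⊔_) renaming (suc to lsuc)
open import Data.Nat using (ℕ; zero; suc; _≤_; _^_)
open import Data.Nat.Primality using (Prime)
open import Data.Fin using (Fin) renaming (zero to fzero; suc to fsuc)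
open import Data.Fin.Subset using (Subset; _∈_; _∉_; ∣_∣)
open import Data.Product using (Σ; ∃; _×_)
open import Relation.Nullary using (¬_)
open import Relation.Binary.PropositionalEquality using (_≡_)
open import Algebra.Bundles using (CommutativeRing)

IsPrimePower : ℕ → Set
IsPrimePower q = Σ ℕ λ p → Σ ℕ λ e → Prime p × (1 ≤ e) × (q ≡ p ^ e)

record FiniteField (c ℓ : Level) (q : ℕ) : Set (lsuc (c ⊔ ℓ)) where
  field
    commRing : CommutativeRing c ℓ
  open CommutativeRing commRing public
  field
    0≉1     : ¬ (0# ≈ 1#)
    inverse : ∀ x → ¬ (x ≈ 0#) → Σ Carrier λ y → x * y ≈ 1#
    toFin   : Carrier → Fin q
    fromFin : Fin q → Carrier
    toFin-cong : ∀ {x y} → x ≈ y → toFin x ≡ toFin y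
    from-to : ∀ x → fromFin (toFin x) ≈ x
    to-from : ∀ i → toFin (fromFin i) ≡ i

module Codes {c ℓ : Level} {q : ℕ} (F : FiniteField c ℓ q) where
  open FiniteField F

  Word : ℕ → Set c
  Word n = Fin n → Carrier

  sumF : ∀ {k} → (Fin k → Carrier) → Carrier
  sumF {zero}  f = 0#
  sumF {suc k} f = f fzero + sumF (λ i → f (fsuc i))

  lincomb : ∀ {k n} → (Fin k → Word n) → Word k → Word n
  lincomb G a j = sumF (λ i → a i * G i j)

  LinIndep : ∀ {k n} → (Fin k → Word n) → Set (c ⊔ ℓ)
  LinIndep G = ∀ a → (∀ j → lincomb G a j ≈ 0#) → ∀ i → a i ≈ 0#

  InSpan : ∀ {k n} → (Fin k → Word n) → Word _ → Set (c ⊔ ℓ)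
  InSpan {k} {n} G x = Σ (Word k) λ a → ∀ j → x j ≈ lincomb G a j

  HasLocality : ∀ {k n} → (Fin k → Word n) → ℕ → Set (c ⊔ ℓ)
  HasLocality {k} {n} G r =
    ∀ (i : Fin n) → Σ (Subset n) λ S →
      (i ∉ S) × (∣ S ∣ ≤ r) ×
      (∀ (x y : Word n) → InSpan G x → InSpan G y →
         (∀ j → j ∈ S → x j ≈ y j) → x i ≈ y i)

  -- there is an [n,k]_q-code with locality r: a k-dimensional subspace
  -- of F^n, given by a basis (the k linearly independent rows of G)
  ExistsCode : ℕ → ℕ → ℕ → Set (c ⊔ ℓ)
  ExistsCode n k r = Σ (Fin k → Word n) λ G → LinIndep G × HasLocality G r

  IsMinLength : ℕ → ℕ → ℕ → Set (c ⊔ ℓ)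
  IsMinLength k r m = ExistsCode m k r × (∀ n → ExistsCode n k r → m ≤ n)

module Submission where

-- Lower bound: starting from T = D = ∅, repeatedly pick a coordinate i outside the set D of
-- coordinates recovered by T, and add to T the s ≤ r points of a repair set of i that are not yet
-- in D; then D grows by at least s + 1 points. At the end T recovers all n coordinates and
-- (r + 1)∣T∣ ≤ r n. Restriction to T is injective on the q ^ k codewords, so k ≤ ∣T∣, whence
-- (r + 1) k ≤ r n. Upper bound: the [r + 1, r] single-parity-check code has locality r, and
-- locality is preserved under direct sums; k copies of the [2, 1] code, respectively ⌊k/2⌋ copies
-- of the [3, 2] code plus one [2, 1] code when k is odd, attain 2k and ⌈3k/2⌉.

open import Defs
open import Level using (Level; _⊔_)
import Data.Nat as Nat
open Nat using (ℕ; zero; suc; _^_; _≤_; _<_; z≤n; s≤s; ⌈_/2⌉)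
open import Data.Nat.Properties
  using (≤-refl; ≤-reflexive; ≤-trans; ≤-<-trans; <⇒≱; ≮⇒≥; +-suc; +-mono-≤; +-monoʳ-≤; *-monoʳ-≤;
         *-zeroʳ; *-suc; *-identityˡ; *-distribˡ-+; m≤m+n; ^-monoʳ-<; ⌈n/2⌉-mono; n≡⌈n+n/2⌉;
         module ≤-Reasoning)
open import Data.Nat.Tactic.RingSolver using (solve-∀)
open import Data.Fin using (Fin; _↑ˡ_; _↑ʳ_; funToFin; finToFun; combine) renaming (zero to fzero; suc to fsuc)
open import Data.Fin.Properties
  using (suc-injective; punchInᵢ≢i; injective⇒≤; funToFin-finToFin; finToFun-funToFin; all?; ¬∀⟶∃¬)
open import Data.Fin.Subset using (Subset; inside; outside; _∈_; _∉_; _∪_; _─_; ∁; ⁅_⁆; ∣_∣) renaming (⊥ to ∅)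
open import Data.Fin.Subset.Properties
  using (_∈?_; ∉⊥; ∈⊤; ⊆⊤; x∈⁅x⁆; x∈⁅y⁆⇒x≡y; x≢y⇒x∉⁅y⁆; x∈∁p⇒x∉p; x∉p⇒x∈∁p; x∈p∪q⁻; x∈p∪q⁺;
         p⊆p∪q; q⊆p∪q; x∈p∧x∉q⇒x∈p─q; ∣⊥∣≡0; ∣⊤∣≡n; ∣⁅x⁆∣≡1; ∣p∣≤n; ∣∁p∣≡n∸∣p∣; ∣p─q∣≤∣p∣;
         ∣p∣≤∣p∪q∣; p⊂q⇒∣p∣<∣q∣)
open import Data.Vec using (_∷_; []; _++_; here; there)
open import Data.Vec.Functional as Vector using (Vector; removeAt; replicate) renaming (_++_ to _++ᵥ_)
open import Data.Vec.Functional.Properties using (lookup-++ˡ; lookup-++ʳ)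
open import Data.Product using (Σ; _×_; _,_)
open import Data.Sum using (inj₂; [_,_]′)
open import Relation.Nullary using (yes; no)
open import Relation.Binary.PropositionalEquality as ≡ using (_≡_; _≢_; _≗_; cong; cong₂)
open import Data.Empty using (⊥-elim)
open import Function using (_∘_)

module _ where
  open Nat using (_+_; _*_)
  open import Data.Nat.Properties using (+-identityʳ)

  ∣p∪q∣≡∣p∣+∣q─p∣ : ∀ {n} (p q : Subset n) → ∣ p ∪ q ∣ ≡ ∣ p ∣ + ∣ q ─ p ∣
  ∣p∪q∣≡∣p∣+∣q─p∣ []            []            = ≡.refl
  ∣p∪q∣≡∣p∣+∣q─p∣ (inside  ∷ p) (_       ∷ q) = cong suc (∣p∪q∣≡∣p∣+∣q─p∣ p q)
  ∣p∪q∣≡∣p∣+∣q─p∣ (outside ∷ p) (outside ∷ q) = ∣p∪q∣≡∣p∣+∣q─p∣ p q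
  ∣p∪q∣≡∣p∣+∣q─p∣ (outside ∷ p) (inside  ∷ q) =
    ≡.trans (cong suc (∣p∪q∣≡∣p∣+∣q─p∣ p q)) (≡.sym (+-suc ∣ p ∣ ∣ q ─ p ∣))

  ∣p∪q∣≤∣p∣+∣q∣ : ∀ {n} (p q : Subset n) → ∣ p ∪ q ∣ ≤ ∣ p ∣ + ∣ q ∣
  ∣p∪q∣≤∣p∣+∣q∣ p q = ≤-trans (≤-reflexive (∣p∪q∣≡∣p∣+∣q─p∣ p q)) (+-monoʳ-≤ ∣ p ∣ (∣p─q∣≤∣p∣ q p))

  ∣p++⊥∣≡∣p∣ : ∀ {m n} (p : Subset m) → ∣ p ++ ∅ {n} ∣ ≡ ∣ p ∣
  ∣p++⊥∣≡∣p∣ {n = n} []  = ∣⊥∣≡0 n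
  ∣p++⊥∣≡∣p∣ (inside  ∷ p) = cong suc (∣p++⊥∣≡∣p∣ p)
  ∣p++⊥∣≡∣p∣ (outside ∷ p) = ∣p++⊥∣≡∣p∣ p

  ∣⊥++p∣≡∣p∣ : ∀ m {n} (p : Subset n) → ∣ ∅ {m} ++ p ∣ ≡ ∣ p ∣
  ∣⊥++p∣≡∣p∣ zero    p = ≡.refl
  ∣⊥++p∣≡∣p∣ (suc m) p = ∣⊥++p∣≡∣p∣ m p

  ∈-++⁺ˡ : ∀ {m n} {i : Fin m} {p : Subset m} (q : Subset n) → i ∈ p → i ↑ˡ n ∈ p ++ q
  ∈-++⁺ˡ q here        = here
  ∈-++⁺ˡ q (there i∈p) = there (∈-++⁺ˡ q i∈p)

  ∈-++⁻ˡ : ∀ {m n} (i : Fin m) (p : Subset m) {q : Subset n} → i ↑ˡ n ∈ p ++ q → i ∈ p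
  ∈-++⁻ˡ fzero    (_ ∷ p) here        = here
  ∈-++⁻ˡ (fsuc i) (_ ∷ p) (there i∈p) = there (∈-++⁻ˡ i p i∈p)

  ∈-++⁺ʳ : ∀ {m n} {i : Fin n} (p : Subset m) {q : Subset n} → i ∈ q → m ↑ʳ i ∈ p ++ q
  ∈-++⁺ʳ []      i∈q = i∈q
  ∈-++⁺ʳ (_ ∷ p) i∈q = there (∈-++⁺ʳ p i∈q)

  ∈-++⁻ʳ : ∀ {m n} {i : Fin n} (p : Subset m) {q : Subset n} → m ↑ʳ i ∈ p ++ q → i ∈ q
  ∈-++⁻ʳ []      i∈q         = i∈q
  ∈-++⁻ʳ (_ ∷ p) (there i∈q) = ∈-++⁻ʳ p i∈q

  ↑-elim : ∀ {p} {m n} (P : Fin (m + n) → Set p) →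
           (∀ i → P (i ↑ˡ n)) → (∀ i → P (m ↑ʳ i)) → ∀ j → P j
  ↑-elim {m = zero}  P left right j        = right j
  ↑-elim {m = suc m} P left right fzero    = left fzero
  ↑-elim {m = suc m} P left right (fsuc j) = ↑-elim (P ∘ fsuc) (left ∘ fsuc) right j

  ⌈2*n/2⌉≡n : ∀ n → ⌈ 2 * n /2⌉ ≡ n
  ⌈2*n/2⌉≡n n = ≡.trans (cong (λ m → ⌈ n + m /2⌉) (+-identityʳ n)) (≡.sym (n≡⌈n+n/2⌉ n))

  x∉p⇒∣p∣<n : ∀ {n} {x : Fin n} {p : Subset n} → x ∉ p → ∣ p ∣ < n
  x∉p⇒∣p∣<n {n} {x} {p} x∉p = ≡.subst (∣ p ∣ <_) (∣⊤∣≡n n) (p⊂q⇒∣p∣<∣q∣ (⊆⊤ , x , ∈⊤ , x∉p))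

  x∉p⇒∣p∣<∣p∪⁅x⁆∣ : ∀ {n} {x : Fin n} {p : Subset n} → x ∉ p → ∣ p ∣ < ∣ p ∪ ⁅ x ⁆ ∣
  x∉p⇒∣p∣<∣p∪⁅x⁆∣ {x = x} {p} x∉p = p⊂q⇒∣p∣<∣q∣ (p⊆p∪q ⁅ x ⁆ , x , x∈p∪q⁺ (inj₂ (x∈⁅x⁆ x)) , x∉p)

  ≢⇒1<n : ∀ {n} (i j : Fin n) → i ≢ j → 1 < n
  ≢⇒1<n {suc zero}    fzero fzero i≢j = ⊥-elim (i≢j ≡.refl)
  ≢⇒1<n {suc (suc n)} i     j     i≢j = s≤s (s≤s z≤n)

  funToFin-cong : ∀ {m n} {f g : Fin m → Fin n} → f ≗ g → funToFin f ≡ funToFin g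
  funToFin-cong {zero}  f≗g = ≡.refl
  funToFin-cong {suc m} f≗g = cong₂ combine (f≗g fzero) (funToFin-cong (f≗g ∘ fsuc))

  finToFun-injective : ∀ m n {x y : Fin (m ^ n)} → finToFun {m} {n} x ≗ finToFun y → x ≡ y
  finToFun-injective m n {x} {y} eq = ≡.trans (≡.sym (funToFin-finToFin {n} {m} x))
    (≡.trans (funToFin-cong eq) (funToFin-finToFin {n} {m} y))

  funToFin-injective : ∀ {m n} {f g : Fin m → Fin n} → funToFin f ≡ funToFin g → f ≗ g
  funToFin-injective {f = f} {g} eq i =
    ≡.trans (≡.sym (finToFun-funToFin f i)) (≡.trans (cong (λ x → finToFun x i) eq) (finToFun-funToFin g i))

  restrict : ∀ {a} {A : Set a} {n} (T : Subset n) → Vector A n → Vector A ∣ T ∣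
  restrict []            u = λ ()
  restrict (inside  ∷ T) u = u fzero Vector.∷ restrict T (u ∘ fsuc)
  restrict (outside ∷ T) u = restrict T (u ∘ fsuc)

  restrict-injective : ∀ {a} {A : Set a} {n} (T : Subset n) {u v : Vector A n} →
                       restrict T u ≗ restrict T v → ∀ j → j ∈ T → u j ≡ v j
  restrict-injective (inside  ∷ T) eq fzero    here        = eq fzero
  restrict-injective (inside  ∷ T) eq (fsuc j) (there j∈T) = restrict-injective T (eq ∘ fsuc) j j∈T
  restrict-injective (outside ∷ T) eq (fsuc j) (there j∈T) = restrict-injective T eq j j∈T

  greedy-step-bound : ∀ r t d s → suc r * t ≤ r * d → s ≤ r → suc r * (t + s) ≤ r * suc (d + s)
  greedy-step-bound r t d s rt≤rd s≤r = begin
    suc r * (t + s)         ≡⟨ expand r t s ⟩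
    suc r * t + (s + r * s) ≤⟨ +-mono-≤ rt≤rd (+-mono-≤ s≤r ≤-refl) ⟩
    r * d + (r + r * s)     ≡⟨ collect r d s ⟩
    r * suc (d + s)         ∎
    where
    open ≤-Reasoning
    expand : ∀ r t s → suc r * (t + s) ≡ suc r * t + (s + r * s)
    expand = solve-∀
    collect : ∀ r d s → r * d + (r + r * s) ≡ r * suc (d + s)
    collect = solve-∀

module _ {c ℓ : Level} {q : ℕ} (F : FiniteField c ℓ q) where
  open FiniteField F
  open Codes F
  open import Algebra.Properties.Semiring.Sum semiring
    using (sum; sum-cong-≋; ∑-distrib-+; sum-replicate-zero; sum-remove)
  open import Algebra.Properties.Ring ring
    using (-‿+-comm; -0#≈0#; [y-z]x≈yx-zx; x∙y⁻¹≈ε⇒x≈y; x≈y⇒x∙y⁻¹≈ε; +-cancelʳ)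
  import Relation.Binary.Reasoning.Setoid as SetoidReasoning
  module ≈-Reasoning = SetoidReasoning setoid

  Recoverable : ∀ {p n} → (Word n → Set p) → Subset n → Fin n → Set (c ⊔ ℓ ⊔ p)
  Recoverable C S i = ∀ x y → C x → C y → (∀ j → j ∈ S → x j ≈ y j) → x i ≈ y i

  -- HasLocality G r unfolds to ∀ i → RepairSet (InSpan G) r i.
  RepairSet : ∀ {p n} → (Word n → Set p) → ℕ → Fin n → Set (c ⊔ ℓ ⊔ p)
  RepairSet {n = n} C r i = Σ (Subset n) λ S → i ∉ S × ∣ S ∣ ≤ r × Recoverable C S i

  sumF≡sum : ∀ {k} (f : Vector Carrier k) → sumF f ≡ sum f
  sumF≡sum {zero}  f = ≡.refl
  sumF≡sum {suc k} f = cong (f fzero +_) (sumF≡sum (f ∘ fsuc))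

  sum-≈0 : ∀ {k} {f : Vector Carrier k} → (∀ i → f i ≈ 0#) → sum f ≈ 0#
  sum-≈0 {k} f≈0 = trans (sum-cong-≋ f≈0) (sum-replicate-zero k)

  sum-neg : ∀ {k} (f : Vector Carrier k) → sum (λ i → - f i) ≈ - sum f
  sum-neg {zero}  f = sym -0#≈0#
  sum-neg {suc k} f = trans (+-cong refl (sum-neg (f ∘ fsuc))) (-‿+-comm _ _)

  sum-↑ : ∀ m {n} (f : Vector Carrier (m Nat.+ n)) → sum f ≈ sum (f ∘ (_↑ˡ n)) + sum (f ∘ (m ↑ʳ_))
  sum-↑ zero    f = sym (+-identityˡ _)
  sum-↑ (suc m) f = trans (+-cong refl (sum-↑ m (f ∘ fsuc))) (sym (+-assoc _ _ _))

  sum-↑ˡ : ∀ m {n} {f : Vector Carrier (m Nat.+ n)} {g : Vector Carrier m} →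
           (∀ i → f (i ↑ˡ n) ≈ g i) → (∀ i → f (m ↑ʳ i) ≈ 0#) → sum f ≈ sum g
  sum-↑ˡ m {f = f} f≈g f≈0 = trans (sum-↑ m f) (trans (+-cong (sum-cong-≋ f≈g) (sum-≈0 f≈0)) (+-identityʳ _))

  sum-↑ʳ : ∀ m {n} {f : Vector Carrier (m Nat.+ n)} {g : Vector Carrier n} →
           (∀ i → f (i ↑ˡ n) ≈ 0#) → (∀ i → f (m ↑ʳ i) ≈ g i) → sum f ≈ sum g
  sum-↑ʳ m {f = f} f≈0 f≈g = trans (sum-↑ m f) (trans (+-cong (sum-≈0 f≈0) (sum-cong-≋ f≈g)) (+-identityˡ _))

  lincomb≡sum : ∀ {k n} (G : Fin k → Word n) a j → lincomb G a j ≡ sum (λ i → a i * G i j)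
  lincomb≡sum G a j = sumF≡sum (λ i → a i * G i j)

  lincomb-─ : ∀ {k n} (G : Fin k → Word n) a b j →
              lincomb G (λ i → a i - b i) j ≈ lincomb G a j - lincomb G b j
  lincomb-─ G a b j = begin
    lincomb G (λ i → a i - b i) j                         ≡⟨ lincomb≡sum G _ j ⟩
    sum (λ i → (a i - b i) * G i j)                       ≈⟨ sum-cong-≋ (λ i → [y-z]x≈yx-zx (G i j) (a i) (b i)) ⟩
    sum (λ i → a i * G i j - b i * G i j)                 ≈⟨ ∑-distrib-+ (λ i → a i * G i j) (λ i → - (b i * G i j)) ⟩
    sum (λ i → a i * G i j) + sum (λ i → - (b i * G i j)) ≈⟨ +-cong (reflexive (≡.sym (lincomb≡sum G a j)))
                                                                     (sum-neg (λ i → b i * G i j)) ⟩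
    lincomb G a j - sum (λ i → b i * G i j)               ≡⟨ cong (λ z → lincomb G a j - z) (lincomb≡sum G b j) ⟨
    lincomb G a j - lincomb G b j                         ∎
    where open ≈-Reasoning

  lincomb-injective : ∀ {k n} {G : Fin k → Word n} → LinIndep G →
                      ∀ a b → (∀ j → lincomb G a j ≈ lincomb G b j) → ∀ i → a i ≈ b i
  lincomb-injective {G = G} indep a b same i = x∙y⁻¹≈ε⇒x≈y (a i) (b i)
    (indep (λ i → a i - b i) (λ j → trans (lincomb-─ G a b j) (x≈y⇒x∙y⁻¹≈ε (same j))) i)

  δ : ∀ {k} → Fin k → Fin k → Carrier
  δ fzero    fzero    = 1#
  δ fzero    (fsuc j) = 0#
  δ (fsuc i) fzero    = 0#
  δ (fsuc i) (fsuc j) = δ i j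

  sum-δ : ∀ {k} (a : Vector Carrier k) j → sum (λ i → a i * δ i j) ≈ a j
  sum-δ {suc k} a fzero    = trans (+-cong (*-identityʳ _) (sum-≈0 (λ i → zeroʳ (a (fsuc i))))) (+-identityʳ _)
  sum-δ {suc k} a (fsuc j) = trans (+-cong (zeroʳ _) (sum-δ (a ∘ fsuc) j)) (+-identityˡ _)

  -- The [r+1, r] single-parity-check code: coordinate 0 carries the sum of the others.
  parityCode : ∀ r → Fin r → Word (suc r)
  parityCode r i fzero    = 1#
  parityCode r i (fsuc j) = δ i j

  lincomb-parityCode-suc : ∀ {r} (a : Word r) j → lincomb (parityCode r) a (fsuc j) ≈ a j
  lincomb-parityCode-suc {r} a j = trans (reflexive (lincomb≡sum (parityCode r) a (fsuc j))) (sum-δ a j)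

  parityCode-linIndep : ∀ r → LinIndep (parityCode r)
  parityCode-linIndep r a lincomb≈0 i = trans (sym (lincomb-parityCode-suc a i)) (lincomb≈0 (fsuc i))

  parity-check : ∀ {r} {x : Word (suc r)} → InSpan (parityCode r) x → x fzero ≈ sum (x ∘ fsuc)
  parity-check {r} {x} (a , x≈) = begin
    x fzero                            ≈⟨ x≈ fzero ⟩
    lincomb (parityCode r) a fzero     ≡⟨ lincomb≡sum (parityCode r) a fzero ⟩
    sum (λ i → a i * 1#)               ≈⟨ sum-cong-≋ (λ i → trans (*-identityʳ (a i))
                                                                 (sym (lincomb-parityCode-suc a i))) ⟩
    sum (lincomb (parityCode r) a ∘ fsuc) ≈⟨ sum-cong-≋ (λ i → x≈ (fsuc i)) ⟨
    sum (x ∘ fsuc)                     ∎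
    where open ≈-Reasoning

  parityCode-recover : ∀ {r} j {x y : Word (suc r)} → InSpan (parityCode r) x → InSpan (parityCode r) y →
                       (∀ s → s ≢ j → x s ≈ y s) → x j ≈ y j
  parityCode-recover fzero x∈ y∈ agree =
    trans (parity-check x∈) (trans (sum-cong-≋ (λ i → agree (fsuc i) λ ())) (sym (parity-check y∈)))
  parityCode-recover {suc r} (fsuc j) {x} {y} x∈ y∈ agree = +-cancelʳ _ (x (fsuc j)) (y (fsuc j)) (begin
    x (fsuc j) + sum (removeAt (x ∘ fsuc) j) ≈⟨ sum-remove (x ∘ fsuc) ⟨
    sum (x ∘ fsuc)                           ≈⟨ parity-check x∈ ⟨
    x fzero                                  ≈⟨ agree fzero (λ ()) ⟩
    y fzero                                  ≈⟨ parity-check y∈ ⟩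
    sum (y ∘ fsuc)                           ≈⟨ sum-remove (y ∘ fsuc) ⟩
    y (fsuc j) + sum (removeAt (y ∘ fsuc) j) ≈⟨ +-cong refl (sum-cong-≋ λ i →
                                                  agree _ (punchInᵢ≢i j i ∘ suc-injective)) ⟨
    y (fsuc j) + sum (removeAt (x ∘ fsuc) j) ∎)
    where open ≈-Reasoning

  parityCode-locality : ∀ r → HasLocality (parityCode r) r
  parityCode-locality r j =
    ∁ ⁅ j ⁆ ,
    (λ j∈∁ → x∈∁p⇒x∉p j∈∁ (x∈⁅x⁆ j)) ,
    ≤-reflexive (≡.trans (∣∁p∣≡n∸∣p∣ ⁅ j ⁆) (cong (suc r Nat.∸_) (∣⁅x⁆∣≡1 j))) ,
    λ x y x∈ y∈ agree → parityCode-recover j x∈ y∈ (λ s s≢j → agree s (x∉p⇒x∈∁p (x≢y⇒x∉⁅y⁆ s≢j)))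

  _⊕_ : ∀ {k₁ n₁ k₂ n₂} → (Fin k₁ → Word n₁) → (Fin k₂ → Word n₂) → Fin (k₁ Nat.+ k₂) → Word (n₁ Nat.+ n₂)
  _⊕_ {n₁ = n₁} {n₂ = n₂} G₁ G₂ =
    (λ i → G₁ i ++ᵥ replicate n₂ 0#) ++ᵥ (λ i → replicate n₁ 0# ++ᵥ G₂ i)

  module _ {k₁ n₁ k₂ n₂} (G₁ : Fin k₁ → Word n₁) (G₂ : Fin k₂ → Word n₂) where

    private
      upper : Fin k₁ → Word (n₁ Nat.+ n₂)
      upper i = G₁ i ++ᵥ replicate n₂ 0#
      lower : Fin k₂ → Word (n₁ Nat.+ n₂)
      lower i = replicate n₁ 0# ++ᵥ G₂ i

    ⊕-↑ˡ-↑ˡ : ∀ i j → (G₁ ⊕ G₂) (i ↑ˡ k₂) (j ↑ˡ n₂) ≡ G₁ i j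
    ⊕-↑ˡ-↑ˡ i j = ≡.trans (cong (λ row → row (j ↑ˡ n₂)) (lookup-++ˡ upper lower i))
      (lookup-++ˡ (G₁ i) (replicate n₂ 0#) j)

    ⊕-↑ʳ-↑ˡ : ∀ i j → (G₁ ⊕ G₂) (k₁ ↑ʳ i) (j ↑ˡ n₂) ≡ 0#
    ⊕-↑ʳ-↑ˡ i j = ≡.trans (cong (λ row → row (j ↑ˡ n₂)) (lookup-++ʳ upper lower i))
      (lookup-++ˡ (replicate n₁ 0#) (G₂ i) j)

    ⊕-↑ˡ-↑ʳ : ∀ i j → (G₁ ⊕ G₂) (i ↑ˡ k₂) (n₁ ↑ʳ j) ≡ 0#
    ⊕-↑ˡ-↑ʳ i j = ≡.trans (cong (λ row → row (n₁ ↑ʳ j)) (lookup-++ˡ upper lower i))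
      (lookup-++ʳ (G₁ i) (replicate n₂ 0#) j)

    ⊕-↑ʳ-↑ʳ : ∀ i j → (G₁ ⊕ G₂) (k₁ ↑ʳ i) (n₁ ↑ʳ j) ≡ G₂ i j
    ⊕-↑ʳ-↑ʳ i j = ≡.trans (cong (λ row → row (n₁ ↑ʳ j)) (lookup-++ʳ upper lower i))
      (lookup-++ʳ (replicate n₁ 0#) (G₂ i) j)

    lincomb-⊕ˡ : ∀ a j → lincomb (G₁ ⊕ G₂) a (j ↑ˡ n₂) ≈ lincomb G₁ (a ∘ (_↑ˡ k₂)) j
    lincomb-⊕ˡ a j = begin
      lincomb (G₁ ⊕ G₂) a (j ↑ˡ n₂)            ≡⟨ lincomb≡sum (G₁ ⊕ G₂) a (j ↑ˡ n₂) ⟩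
      sum (λ i → a i * (G₁ ⊕ G₂) i (j ↑ˡ n₂))  ≈⟨ sum-↑ˡ k₁ (λ i → *-congˡ (reflexive (⊕-↑ˡ-↑ˡ i j)))
                                                     (λ i → trans (*-congˡ (reflexive (⊕-↑ʳ-↑ˡ i j))) (zeroʳ _)) ⟩
      sum (λ i → a (i ↑ˡ k₂) * G₁ i j)         ≡⟨ lincomb≡sum G₁ (a ∘ (_↑ˡ k₂)) j ⟨
      lincomb G₁ (a ∘ (_↑ˡ k₂)) j              ∎
      where open ≈-Reasoning

    lincomb-⊕ʳ : ∀ a j → lincomb (G₁ ⊕ G₂) a (n₁ ↑ʳ j) ≈ lincomb G₂ (a ∘ (k₁ ↑ʳ_)) j
    lincomb-⊕ʳ a j = begin
      lincomb (G₁ ⊕ G₂) a (n₁ ↑ʳ j)            ≡⟨ lincomb≡sum (G₁ ⊕ G₂) a (n₁ ↑ʳ j) ⟩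
      sum (λ i → a i * (G₁ ⊕ G₂) i (n₁ ↑ʳ j))  ≈⟨ sum-↑ʳ k₁ (λ i → trans (*-congˡ (reflexive (⊕-↑ˡ-↑ʳ i j))) (zeroʳ _))
                                                     (λ i → *-congˡ (reflexive (⊕-↑ʳ-↑ʳ i j))) ⟩
      sum (λ i → a (k₁ ↑ʳ i) * G₂ i j)         ≡⟨ lincomb≡sum G₂ (a ∘ (k₁ ↑ʳ_)) j ⟨
      lincomb G₂ (a ∘ (k₁ ↑ʳ_)) j              ∎
      where open ≈-Reasoning

    inSpan-⊕ˡ : ∀ {x} → InSpan (G₁ ⊕ G₂) x → InSpan G₁ (x ∘ (_↑ˡ n₂))
    inSpan-⊕ˡ (a , x≈) = a ∘ (_↑ˡ k₂) , λ j → trans (x≈ (j ↑ˡ n₂)) (lincomb-⊕ˡ a j)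

    inSpan-⊕ʳ : ∀ {x} → InSpan (G₁ ⊕ G₂) x → InSpan G₂ (x ∘ (n₁ ↑ʳ_))
    inSpan-⊕ʳ (a , x≈) = a ∘ (k₁ ↑ʳ_) , λ j → trans (x≈ (n₁ ↑ʳ j)) (lincomb-⊕ʳ a j)

    linIndep-⊕ : LinIndep G₁ → LinIndep G₂ → LinIndep (G₁ ⊕ G₂)
    linIndep-⊕ indep₁ indep₂ a lincomb≈0 = ↑-elim (λ i → a i ≈ 0#)
      (indep₁ (a ∘ (_↑ˡ k₂)) (λ j → trans (sym (lincomb-⊕ˡ a j)) (lincomb≈0 (j ↑ˡ n₂))))
      (indep₂ (a ∘ (k₁ ↑ʳ_)) (λ j → trans (sym (lincomb-⊕ʳ a j)) (lincomb≈0 (n₁ ↑ʳ j))))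

    hasLocality-⊕ : ∀ {r} → HasLocality G₁ r → HasLocality G₂ r → HasLocality (G₁ ⊕ G₂) r
    hasLocality-⊕ {r} local₁ local₂ = ↑-elim _ upperCoordinate lowerCoordinate
      where
      upperCoordinate : ∀ j → RepairSet (InSpan (G₁ ⊕ G₂)) r (j ↑ˡ n₂)
      upperCoordinate j with local₁ j
      ... | S , j∉S , ∣S∣≤r , recover =
        S ++ ∅ ,
        j∉S ∘ ∈-++⁻ˡ j S ,
        ≤-trans (≤-reflexive (∣p++⊥∣≡∣p∣ S)) ∣S∣≤r ,
        λ x y x∈ y∈ agree → recover _ _ (inSpan-⊕ˡ x∈) (inSpan-⊕ˡ y∈) (λ s s∈S → agree (s ↑ˡ n₂) (∈-++⁺ˡ ∅ s∈S))
      lowerCoordinate : ∀ j → RepairSet (InSpan (G₁ ⊕ G₂)) r (n₁ ↑ʳ j)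
      lowerCoordinate j with local₂ j
      ... | S , j∉S , ∣S∣≤r , recover =
        ∅ ++ S ,
        j∉S ∘ ∈-++⁻ʳ ∅ ,
        ≤-trans (≤-reflexive (∣⊥++p∣≡∣p∣ n₁ S)) ∣S∣≤r ,
        λ x y x∈ y∈ agree → recover _ _ (inSpan-⊕ʳ x∈) (inSpan-⊕ʳ y∈) (λ s s∈S → agree (n₁ ↑ʳ s) (∈-++⁺ʳ ∅ s∈S))

  existsCode-⊕ : ∀ {n₁ k₁ n₂ k₂ r} → ExistsCode n₁ k₁ r → ExistsCode n₂ k₂ r → ExistsCode (n₁ Nat.+ n₂) (k₁ Nat.+ k₂) r
  existsCode-⊕ (G₁ , indep₁ , local₁) (G₂ , indep₂ , local₂) =
    G₁ ⊕ G₂ , linIndep-⊕ G₁ G₂ indep₁ indep₂ , hasLocality-⊕ G₁ G₂ local₁ local₂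

  existsCode-empty : ∀ {r} → ExistsCode 0 0 r
  existsCode-empty = (λ ()) , (λ _ _ ()) , (λ ())

  existsCode-weaken : ∀ {n k r r′} → r ≤ r′ → ExistsCode n k r → ExistsCode n k r′
  existsCode-weaken r≤r′ (G , indep , local) =
    G , indep , λ j → let S , j∉S , ∣S∣≤r , recover = local j in S , j∉S , ≤-trans ∣S∣≤r r≤r′ , recover

  existsCode-parity : ∀ r → ExistsCode (suc r) r r
  existsCode-parity r = parityCode r , parityCode-linIndep r , parityCode-locality r

module _ {c ℓ : Level} {q : ℕ} (F : FiniteField c ℓ q) where
  open FiniteField F using (_≈_; refl; sym; trans; reflexive; 0#; 1#; 0≉1; toFin; fromFin; toFin-cong; from-to; to-from)
  open Codes F using (Word; lincomb; LinIndep; InSpan; HasLocality)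
  open Nat using (_+_; _*_)

  module _ {p} {n r : ℕ} {C : Word n → Set p} where

    module GreedyStep (T D S : Subset n) (i : Fin n) where
      T′ D′ : Subset n
      T′ = T ∪ (S ─ D)
      D′ = (D ∪ S) ∪ ⁅ i ⁆

      i∉D∪S : i ∉ D → i ∉ S → i ∉ D ∪ S
      i∉D∪S i∉D i∉S i∈D∪S = [ i∉D , i∉S ]′ (x∈p∪q⁻ D S i∈D∪S)

      recovers-grown : Recoverable F C S i → (∀ j → j ∈ D → Recoverable F C T j) →
                       ∀ j → j ∈ D′ → Recoverable F C T′ j
      recovers-grown recover-i recover-D j j∈D′ x y x∈C y∈C agree-T′ =
        [ agree-D∪S j , (λ j∈⁅i⁆ → ≡.subst (λ j → x j ≈ y j) (≡.sym (x∈⁅y⁆⇒x≡y i j∈⁅i⁆)) agree-i) ]′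
          (x∈p∪q⁻ (D ∪ S) ⁅ i ⁆ j∈D′)
        where
        agree-D : ∀ j → j ∈ D → x j ≈ y j
        agree-D j j∈D = recover-D j j∈D x y x∈C y∈C (λ t t∈T → agree-T′ t (p⊆p∪q (S ─ D) t∈T))
        agree-S : ∀ j → j ∈ S → x j ≈ y j
        agree-S j j∈S with j ∈? D
        ... | yes j∈D = agree-D j j∈D
        ... | no  j∉D = agree-T′ j (q⊆p∪q T (S ─ D) (x∈p∧x∉q⇒x∈p─q j∈S j∉D))
        agree-D∪S : ∀ j → j ∈ D ∪ S → x j ≈ y j
        agree-D∪S j j∈D∪S = [ agree-D j , agree-S j ]′ (x∈p∪q⁻ D S j∈D∪S)
        agree-i : x i ≈ y i
        agree-i = recover-i x y x∈C y∈C agree-S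

      bound-grown : i ∉ D → i ∉ S → ∣ S ∣ ≤ r → suc r * ∣ T ∣ ≤ r * ∣ D ∣ → suc r * ∣ T′ ∣ ≤ r * ∣ D′ ∣
      bound-grown i∉D i∉S ∣S∣≤r bound = begin
        suc r * ∣ T′ ∣                   ≤⟨ *-monoʳ-≤ (suc r) (∣p∪q∣≤∣p∣+∣q∣ T (S ─ D)) ⟩
        suc r * (∣ T ∣ + ∣ S ─ D ∣)       ≤⟨ greedy-step-bound r _ _ _ bound (≤-trans (∣p─q∣≤∣p∣ S D) ∣S∣≤r) ⟩
        r * suc (∣ D ∣ + ∣ S ─ D ∣)       ≡⟨ cong (λ d → r * suc d) (∣p∪q∣≡∣p∣+∣q─p∣ D S) ⟨
        r * suc ∣ D ∪ S ∣                ≤⟨ *-monoʳ-≤ r (x∉p⇒∣p∣<∣p∪⁅x⁆∣ (i∉D∪S i∉D i∉S)) ⟩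
        r * ∣ D′ ∣                       ∎
        where open ≤-Reasoning

      ∣D∣<∣D′∣ : i ∉ D → i ∉ S → ∣ D ∣ < ∣ D′ ∣
      ∣D∣<∣D′∣ i∉D i∉S = ≤-<-trans (∣p∣≤∣p∪q∣ D S) (x∉p⇒∣p∣<∣p∪⁅x⁆∣ (i∉D∪S i∉D i∉S))

    module _ (repair : ∀ i → RepairSet F C r i) where

      -- The fuel m only serves termination: each step enlarges D, and ∣ D ∣ ≤ n.
      grow : ∀ m (T D : Subset n) → n ≤ m + ∣ D ∣ → (∀ j → j ∈ D → Recoverable F C T j) →
             suc r * ∣ T ∣ ≤ r * ∣ D ∣ → Σ (Subset n) λ T → (∀ j → Recoverable F C T j) × suc r * ∣ T ∣ ≤ r * n
      grow m T D fuel recover-D bound with all? (_∈? D)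
      ... | yes all∈D = T , (λ j → recover-D j (all∈D j)) , ≤-trans bound (*-monoʳ-≤ r (∣p∣≤n D))
      ... | no ¬all∈D with ¬∀⟶∃¬ n (_∈ D) (_∈? D) ¬all∈D
      ...   | i , i∉D with m | repair i
      ...     | zero  | _ = ⊥-elim (<⇒≱ (x∉p⇒∣p∣<n i∉D) fuel)
      ...     | suc m | S , i∉S , ∣S∣≤r , recover-i =
        grow m T′ D′ fuel′ (recovers-grown recover-i recover-D) (bound-grown i∉D i∉S ∣S∣≤r bound)
        where
        open GreedyStep T D S i
        fuel′ : n ≤ m + ∣ D′ ∣
        fuel′ = ≤-trans fuel (≤-trans (≤-reflexive (≡.sym (+-suc m ∣ D ∣))) (+-monoʳ-≤ m (∣D∣<∣D′∣ i∉D i∉S)))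

      small-recovering-set : Σ (Subset n) λ T → (∀ j → Recoverable F C T j) × suc r * ∣ T ∣ ≤ r * n
      small-recovering-set = grow n ∅ ∅ (m≤m+n n ∣ ∅ {n} ∣) (λ j j∈∅ → ⊥-elim (∉⊥ j∈∅))
        (≤-trans (≤-reflexive (≡.trans (cong (suc r *_) (∣⊥∣≡0 n)) (*-zeroʳ (suc r)))) z≤n)

  toFin-injective : ∀ {a b} → toFin a ≡ toFin b → a ≈ b
  toFin-injective {a} {b} eq = trans (sym (from-to a)) (trans (reflexive (cong fromFin eq)) (from-to b))

  fromFin-injective : ∀ {i j} → fromFin i ≈ fromFin j → i ≡ j
  fromFin-injective {i} {j} eq = ≡.trans (≡.sym (to-from i)) (≡.trans (toFin-cong eq) (to-from j))

  1<q : 1 < q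
  1<q = ≢⇒1<n (toFin 0#) (toFin 1#) (0≉1 ∘ toFin-injective)

  recovering-set-size : ∀ {k n} {G : Fin k → Word n} {T : Subset n} → LinIndep G →
                        (∀ j → Recoverable F (InSpan G) T j) → k ≤ ∣ T ∣
  recovering-set-size {k} {n} {G} {T} indep recover =
    ≮⇒≥ λ ∣T∣<k → <⇒≱ (^-monoʳ-< q 1<q ∣T∣<k) (injective⇒≤ encode-injective)
    where
    codeword : (Fin k → Fin q) → Word n
    codeword u = lincomb G (fromFin ∘ u)
    encode : Fin (q ^ k) → Fin (q ^ ∣ T ∣)
    encode x = funToFin (restrict T (toFin ∘ codeword (finToFun x)))
    encode-injective : ∀ {x y} → encode x ≡ encode y → x ≡ y
    encode-injective {x} {y} eq =
      finToFun-injective q k (λ i → fromFin-injective (lincomb-injective F indep _ _ same-codeword i))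
      where
      agree-T : ∀ j → j ∈ T → codeword (finToFun x) j ≈ codeword (finToFun y) j
      agree-T j j∈T = toFin-injective (restrict-injective T (funToFin-injective eq) j j∈T)
      same-codeword : ∀ j → codeword (finToFun x) j ≈ codeword (finToFun y) j
      same-codeword j = recover j _ _ (_ , λ _ → refl) (_ , λ _ → refl) agree-T

  locality-bound : ∀ {k n r} {G : Fin k → Word n} → LinIndep G → HasLocality G r → suc r * k ≤ r * n
  locality-bound {r = r} indep local =
    let T , recover , bound = small-recovering-set local
    in  ≤-trans (*-monoʳ-≤ (suc r) (recovering-set-size indep recover)) bound

module _ {c ℓ : Level} {q : ℕ} (F : FiniteField c ℓ q) where
  open Codes F using (ExistsCode; IsMinLength)
  open Nat using (_+_; _*_)

  existsCode-locality-1 : ∀ k → ExistsCode (2 * k) k 1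
  existsCode-locality-1 zero    = existsCode-empty F
  existsCode-locality-1 (suc k) = ≡.subst (λ n → ExistsCode n (suc k) 1) (≡.sym (*-suc 2 k))
    (existsCode-⊕ F (existsCode-parity F 1) (existsCode-locality-1 k))

  existsCode-locality-2 : ∀ k → ExistsCode ⌈ 3 * k /2⌉ k 2
  existsCode-locality-2 0 = existsCode-empty F
  existsCode-locality-2 1 = existsCode-weaken F (s≤s z≤n) (existsCode-parity F 1)
  -- ⌈ 6 + m /2⌉ reduces to 3 + ⌈ m /2⌉, so only 3 * (2 + k) ≡ 6 + 3 * k needs proof.
  existsCode-locality-2 (suc (suc k)) = ≡.subst (λ n → ExistsCode ⌈ n /2⌉ (2 + k) 2) (≡.sym (*-distribˡ-+ 3 2 k))
    (existsCode-⊕ F (existsCode-parity F 2) (existsCode-locality-2 k))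

  minLength-locality-1 : ∀ k → IsMinLength k 1 (2 * k)
  minLength-locality-1 k = existsCode-locality-1 k ,
    λ n (G , indep , local) → ≡.subst (2 * k ≤_) (*-identityˡ n) (locality-bound F indep local)

  minLength-locality-2 : ∀ k → IsMinLength k 2 ⌈ 3 * k /2⌉
  minLength-locality-2 k = existsCode-locality-2 k ,
    λ n (G , indep , local) → ≤-trans (⌈n/2⌉-mono (locality-bound F indep local)) (≤-reflexive (⌈2*n/2⌉≡n n))

open Nat using (_*_)

-- The bounds hold over every finite field and for every k.
proposition14 : ∀ {c ℓ : Level} (q : ℕ) → IsPrimePower q → (F : FiniteField c ℓ q) → (k : ℕ) → 1 ≤ k →
    Codes.IsMinLength F k 1 (2 * k) × Codes.IsMinLength F k 2 ⌈ 3 * k /2⌉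
proposition14 q _ F k _ = minLength-locality-1 F k , minLength-locality-2 F k
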